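{- Let $k\geq 4$ and let $\pi$ be a permutation avoiding every pattern of $B_k$. If $\mathrm{LIS}(\pi)\geq 2k-4$, then $\mathrm{LDS}(\pi)\leq k-2$. Symmetrically, if $\mathrm{LDS}(\pi)\geq 2k-4$, then $\mathrm{LIS}(\pi)\leq k-2$.
   Context: $\mathrm{LIS}(\pi)$ and $\mathrm{LDS}(\pi)$ are the lengths of a longest increasing and a longest decreasing subsequence of $\pi$. Classical pattern containment; $\pi^c$ denotes complement. For $k\ge3$, $p_k=12\cdots(k-2)\,k\,(k-1)$, $q_k=1\,k\,(k-1)\cdots 2$, $r_k=2\,1\,3\,4\cdots k$, $s_k=2\,3\cdots k\,1$, and $B_k=\{p_k,q_k,r_k,s_k,p_k^c,q_k^c,r_k^c,s_k^c\}$. -}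

module Defs where

open import Data.Nat using (ℕ; zero; suc; _+_; _∸_; _<_; _≤_; _≤ᵇ_)
open import Data.Bool using (if_then_else_)
open import Data.Fin using (Fin; toℕ)
open import Data.Product using (Σ; _×_; _,_)
open import Data.List using (List; _∷_; [])
open import Data.List.Relation.Unary.All using (All)
open import Relation.Nullary using (¬_)
open import Relation.Binary.PropositionalEquality using (_≡_)
open import Function.Definitions using (Injective)
open import Function.Bundles using (_⇔_)

-- A permutation of size n: an injective (hence bijective) map Fin n → Fin n.
-- π is the word π(0) π(1) … π(n-1).
record Perm (n : ℕ) : Set where
  field
    fun : Fin n → Fin n
    inj : Injective _≡_ _≡_ fun
open Perm public

StrictIncr : {m n : ℕ} → (Fin m → Fin n) → Set
StrictIncr {m} f = ∀ (i j : Fin m) → toℕ i < toℕ j → toℕ (f i) < toℕ (f j)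

HasIncSub : {n : ℕ} → Perm n → ℕ → Set
HasIncSub {n} π m = Σ (Fin m → Fin n) λ f → StrictIncr f ×
  (∀ (i j : Fin m) → toℕ i < toℕ j → toℕ (fun π (f i)) < toℕ (fun π (f j)))

HasDecSub : {n : ℕ} → Perm n → ℕ → Set
HasDecSub {n} π m = Σ (Fin m → Fin n) λ f → StrictIncr f ×
  (∀ (i j : Fin m) → toℕ i < toℕ j → toℕ (fun π (f j)) < toℕ (fun π (f i)))

IsLIS : {n : ℕ} → Perm n → ℕ → Set
IsLIS π ℓ = HasIncSub π ℓ × (∀ m → HasIncSub π m → m ≤ ℓ)

IsLDS : {n : ℕ} → Perm n → ℕ → Set
IsLDS π ℓ = HasDecSub π ℓ × (∀ m → HasDecSub π m → m ≤ ℓ)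

-- A pattern of length k is given by its one-line notation as a map from
-- 1-indexed positions 1..k to values 1..k (only positions 1..k matter).
Pattern : Set
Pattern = ℕ → ℕ

Contains : {n : ℕ} → Perm n → (k : ℕ) → Pattern → Set
Contains {n} π k σ = Σ (Fin k → Fin n) λ f → StrictIncr f ×
  (∀ (i j : Fin k) →
     (σ (suc (toℕ i)) < σ (suc (toℕ j))) ⇔ (toℕ (fun π (f i)) < toℕ (fun π (f j))))

Avoids : {n : ℕ} → Perm n → (k : ℕ) → List Pattern → Set
Avoids π k Ps = All (λ σ → ¬ Contains π k σ) Ps

-- the patterns, for k ≥ 3, position j ∈ {1,…,k}
-- p_k = 1 2 ⋯ (k-2) k (k-1)
p : ℕ → Pattern
p k j = if j ≤ᵇ (k ∸ 2) then j else (if j ≤ᵇ (k ∸ 1) then k else k ∸ 1)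

-- q_k = 1 k (k-1) ⋯ 2
q : ℕ → Pattern
q k j = if j ≤ᵇ 1 then 1 else (k + 2) ∸ j

-- r_k = 2 1 3 4 ⋯ k
r : ℕ → Pattern
r k j = if j ≤ᵇ 1 then 2 else (if j ≤ᵇ 2 then 1 else j)

-- s_k = 2 3 ⋯ k 1
s : ℕ → Pattern
s k j = if j ≤ᵇ (k ∸ 1) then suc j else 1

comp : ℕ → Pattern → Pattern
comp k σ j = suc k ∸ σ j

B : ℕ → List Pattern
B k = p k ∷ q k ∷ r k ∷ s k ∷ comp k (p k) ∷ comp k (q k) ∷ comp k (r k) ∷ comp k (s k) ∷ []

{-# OPTIONS --safe #-}
module Submission where

-- Write k = K + 2. Take a decreasing subsequence x = D₀, …, D_K = y and an
-- increasing one I₀, …, I_{2K-1}, and put a = I₀, b = I_K. Since x lies left of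
-- and above y, the point a lies in one of four regions, each forcing a pattern
-- of B_k:
--   right of x, below x:  q_kᶜ (x, I₀ … I_K) if b is below x, otherwise
--                         r_k (x, a, I_K … I_{2K-1});
--   left of x, below y:   q_k (a, D₀ … D_K);
--   left of y, above y:   s_k (I₀ … I_K, y) if b is left of y, otherwise
--                         r_k (a, y, I_K … I_{2K-1});
--   right of y, above x:  s_kᶜ (D₀ … D_K, a). Complementing π swaps LIS and LDS and preserves
-- B_k, which gives the second half.

open import Defs
open import Data.Nat using (ℕ; zero; suc; _+_; _≤_; _<_; _∸_; _*_; z≤n; s≤s; _≤ᵇ_)
open import Data.Nat.Properties
open import Data.Bool using (Bool; true; false; T; if_then_else_)
open import Data.Unit using (tt)
open import Data.Fin using (Fin; toℕ; opposite)
open import Data.Fin.Properties using (toℕ-injective; toℕ<n; opposite-prop; opposite-involutive)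
open import Data.Product using (Σ; _×_; _,_; proj₁)
open import Data.Sum using (_⊎_; inj₁; inj₂)
open import Data.Empty using (⊥; ⊥-elim)
open import Data.List.Relation.Unary.All using (_∷_; [])
open import Relation.Nullary using (¬_)
open import Relation.Binary using (tri<; tri≈; tri>)
open import Relation.Binary.PropositionalEquality
open import Function.Base using (_∘_)
open import Function.Bundles using (_⇔_; mk⇔; Equivalence)
open import Function.Construct.Composition using (_⇔-∘_)
open import Function.Definitions using (Injective)

SameOrder : ℕ → ℕ → ℕ → ℕ → Set
SameOrder a b u v = (a < b × u < v) ⊎ (b < a × v < u)

SameOrder-resp : ∀ {a a′ b b′ u v} → a ≡ a′ → b ≡ b′ → SameOrder a′ b′ u v → SameOrder a b u v
SameOrder-resp refl refl ord = ord

Ascending : ℕ → (ℕ → ℕ) → Set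
Ascending N f = ∀ {i j} → i < j → j ≤ N → f i < f j

Descending : ℕ → (ℕ → ℕ) → Set
Descending N f = ∀ {i j} → i < j → j ≤ N → f j < f i

ascending-≤ : ∀ {N f} → Ascending N f → ∀ {i j} → i ≤ j → j ≤ N → f i ≤ f j
ascending-≤ asc i≤j j≤N with m≤n⇒m<n∨m≡n i≤j
... | inj₁ i<j  = <⇒≤ (asc i<j j≤N)
... | inj₂ refl = ≤-refl

descending-≤ : ∀ {N f} → Descending N f → ∀ {i j} → i ≤ j → j ≤ N → f j ≤ f i
descending-≤ desc i≤j j≤N with m≤n⇒m<n∨m≡n i≤j
... | inj₁ i<j  = <⇒≤ (desc i<j j≤N)
... | inj₂ refl = ≤-refl

ascending-restrict : ∀ {M N f} → M ≤ N → Ascending N f → Ascending M f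
ascending-restrict M≤N asc i<j j≤M = asc i<j (≤-trans j≤M M≤N)

ascending-drop : ∀ {N m f} → Ascending (N + m) f → Ascending N (λ i → f (i + m))
ascending-drop {m = m} asc i<j j≤N = asc (+-monoˡ-< m i<j) (+-monoˡ-≤ m j≤N)

infixr 5 _◂_

_◂_ : {A : Set} → A → (ℕ → A) → ℕ → A
(x ◂ xs) zero    = x
(x ◂ xs) (suc i) = xs i

snocAt : {A : Set} → ℕ → (ℕ → A) → A → ℕ → A
snocAt zero    xs y zero    = xs 0
snocAt zero    xs y (suc _) = y
snocAt (suc K) xs y zero    = xs 0
snocAt (suc K) xs y (suc i) = snocAt K (xs ∘ suc) y i

snocAt-≤ : {A : Set} {K i : ℕ} (xs : ℕ → A) (y : A) → i ≤ K → snocAt K xs y i ≡ xs i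
snocAt-≤ {K = zero}  {zero}  xs y _         = refl
snocAt-≤ {K = suc K} {zero}  xs y _         = refl
snocAt-≤ {K = suc K} {suc i} xs y (s≤s i≤K) = snocAt-≤ (xs ∘ suc) y i≤K

snocAt-last : {A : Set} (K : ℕ) (xs : ℕ → A) (y : A) → snocAt K xs y (suc K) ≡ y
snocAt-last zero    xs y = refl
snocAt-last (suc K) xs y = snocAt-last K (xs ∘ suc) y

-- Lets a subsequence Fin (suc A) → Fin n be read as a sequence ℕ → Fin n;
-- indices beyond A are junk.
clamp : (A : ℕ) → ℕ → Fin (suc A)
clamp zero    _       = Fin.zero
clamp (suc A) zero    = Fin.zero
clamp (suc A) (suc j) = Fin.suc (clamp A j)

toℕ-clamp : ∀ {A j} → j ≤ A → toℕ (clamp A j) ≡ j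
toℕ-clamp {zero}  {zero}  _         = refl
toℕ-clamp {suc A} {zero}  _         = refl
toℕ-clamp {suc A} {suc j} (s≤s j≤A) = cong suc (toℕ-clamp j≤A)

clamp-< : ∀ {A i j} → i < j → j ≤ A → toℕ (clamp A i) < toℕ (clamp A j)
clamp-< i<j j≤A = subst₂ _<_ (sym (toℕ-clamp (≤-trans (<⇒≤ i<j) j≤A))) (sym (toℕ-clamp j≤A)) i<j

if-T : {A : Set} (b : Bool) {x y : A} → T b → (if b then x else y) ≡ x
if-T true _ = refl

if-¬T : {A : Set} (b : Bool) {x y : A} → ¬ T b → (if b then x else y) ≡ y
if-¬T true  ¬b = ⊥-elim (¬b tt)
if-¬T false _  = refl

q-tail : ∀ {K j} → j ≤ K → q (2 + K) (2 + j) ≡ 2 + (K ∸ j)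
q-tail {K} {j} j≤K = trans (+-∸-comm 2 j≤K) (+-comm (K ∸ j) 2)

qᶜ-tail : ∀ {K j} → j ≤ K → comp (2 + K) (q (2 + K)) (2 + j) ≡ suc j
qᶜ-tail {K} {j} j≤K = begin
  3 + K ∸ q (2 + K) (2 + j)  ≡⟨ cong (3 + K ∸_) (q-tail j≤K) ⟩
  suc K ∸ (K ∸ j)            ≡⟨ +-∸-assoc 1 (m∸n≤m K j) ⟩
  suc (K ∸ (K ∸ j))          ≡⟨ cong suc (m∸[m∸n]≡n j≤K) ⟩
  suc j                      ∎
  where open ≡-Reasoning

s-init : ∀ {K i} → i ≤ K → s (2 + K) (suc i) ≡ 2 + i
s-init i≤K = if-T _ (≤⇒≤ᵇ (s≤s i≤K))

s-last : ∀ K → s (2 + K) (2 + K) ≡ 1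
s-last K = if-¬T _ (λ t → n≮n (suc K) (≤ᵇ⇒≤ (2 + K) (suc K) t))

sᶜ-init : ∀ {K i} → i ≤ K → comp (2 + K) (s (2 + K)) (suc i) ≡ suc K ∸ i
sᶜ-init {K} i≤K = cong (3 + K ∸_) (s-init i≤K)

sᶜ-last : ∀ K → comp (2 + K) (s (2 + K)) (2 + K) ≡ 2 + K
sᶜ-last K = cong (3 + K ∸_) (s-last K)

-- Elements of Fin n are the points (pos e, val e) of the graph of π. In proof
-- names, e←e′ means pos e < pos e′ and e↓e′ means val e < val e′.
module _ {n : ℕ} (π : Perm n) where

  pos : Fin n → ℕ
  pos = toℕ

  val : Fin n → ℕ
  val = toℕ ∘ fun π

  val-injective : ∀ {e e′} → val e ≡ val e′ → e ≡ e′
  val-injective = inj π ∘ toℕ-injective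

  pos≡⇒val≡ : ∀ {e e′} → pos e ≡ pos e′ → val e ≡ val e′
  pos≡⇒val≡ = cong val ∘ toℕ-injective

  val≡⇒pos≡ : ∀ {e e′} → val e ≡ val e′ → pos e ≡ pos e′
  val≡⇒pos≡ = cong pos ∘ val-injective

  Increasing : (ℕ → Fin n) → ℕ → Set
  Increasing h N = Ascending N (pos ∘ h) × Ascending N (val ∘ h)

  Decreasing : (ℕ → Fin n) → ℕ → Set
  Decreasing h N = Ascending N (pos ∘ h) × Descending N (val ∘ h)

  increasing-prefix : ∀ {m N} → HasIncSub π m → N < m → Σ (ℕ → Fin n) λ I → Increasing I N
  increasing-prefix {suc A} (f , f↑ , πf↑) (s≤s N≤A) =
    f ∘ clamp A ,
    (λ i<j j≤N → f↑ _ _ (clamp-< i<j (≤-trans j≤N N≤A))) ,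
    (λ i<j j≤N → πf↑ _ _ (clamp-< i<j (≤-trans j≤N N≤A)))

  decreasing-prefix : ∀ {m N} → HasDecSub π m → N < m → Σ (ℕ → Fin n) λ D → Decreasing D N
  decreasing-prefix {suc A} (f , f↑ , πf↓) (s≤s N≤A) =
    f ∘ clamp A ,
    (λ i<j j≤N → f↑ _ _ (clamp-< i<j (≤-trans j≤N N≤A))) ,
    (λ i<j j≤N → πf↓ _ _ (clamp-< i<j (≤-trans j≤N N≤A)))

  IsOccurrence : ℕ → Pattern → (ℕ → Fin n) → Set
  IsOccurrence k σ h = ∀ i j → i < j → j < k →
    pos (h i) < pos (h j) × SameOrder (σ (suc i)) (σ (suc j)) (val (h i)) (val (h j))

  occurrence⇒contains : ∀ k σ h → IsOccurrence k σ h → Contains π k σ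
  occurrence⇒contains k σ h occ = h ∘ toℕ , (λ i j i<j → proj₁ (occ _ _ i<j (toℕ<n j))) , sameOrder
    where
    sameOrder : ∀ (i j : Fin k) → (σ (suc (toℕ i)) < σ (suc (toℕ j))) ⇔ (val (h (toℕ i)) < val (h (toℕ j)))
    sameOrder i j with <-cmp (toℕ i) (toℕ j)
    ... | tri< i<j _ _ with occ _ _ i<j (toℕ<n j)
    ...   | _ , inj₁ (a<b , u<v) = mk⇔ (λ _ → u<v) (λ _ → a<b)
    ...   | _ , inj₂ (b<a , v<u) = mk⇔ (⊥-elim ∘ <-asym b<a) (⊥-elim ∘ <-asym v<u)
    sameOrder i j | tri≈ _ i≡j _ =
      mk⇔ (⊥-elim ∘ <-irrefl (cong (σ ∘ suc) i≡j)) (⊥-elim ∘ <-irrefl (cong (val ∘ h) i≡j))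
    sameOrder i j | tri> _ _ j<i with occ _ _ j<i (toℕ<n i)
    ...   | _ , inj₁ (b<a , v<u) = mk⇔ (⊥-elim ∘ <-asym b<a) (⊥-elim ∘ <-asym v<u)
    ...   | _ , inj₂ (a<b , u<v) = mk⇔ (λ _ → u<v) (λ _ → a<b)

  q-occurrence : ∀ K z D → Decreasing D K → pos z < pos (D 0) → val z < val (D K) →
    Contains π (2 + K) (q (2 + K))
  q-occurrence K z D (D→ , D↓) z←D z↓D =
    occurrence⇒contains (2 + K) (q (2 + K)) (z ◂ D) occ
    where
    occ : IsOccurrence (2 + K) (q (2 + K)) (z ◂ D)
    occ zero (suc j) _ (s≤s (s≤s j≤K)) =
      <-≤-trans z←D (ascending-≤ D→ z≤n j≤K) ,
      SameOrder-resp refl (q-tail j≤K) (inj₁ (s≤s (s≤s z≤n) , <-≤-trans z↓D (descending-≤ D↓ j≤K ≤-refl)))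
    occ (suc i) (suc j) (s≤s i<j) (s≤s (s≤s j≤K)) =
      D→ i<j j≤K ,
      SameOrder-resp (q-tail (≤-trans (<⇒≤ i<j) j≤K)) (q-tail j≤K)
        (inj₂ (s≤s (s≤s (∸-monoʳ-< i<j j≤K)) , D↓ i<j j≤K))

  qᶜ-occurrence : ∀ K x I → Increasing I K → pos x < pos (I 0) → val (I K) < val x →
    Contains π (2 + K) (comp (2 + K) (q (2 + K)))
  qᶜ-occurrence K x I (I→ , I↑) x←I I↓x =
    occurrence⇒contains (2 + K) (comp (2 + K) (q (2 + K))) (x ◂ I) occ
    where
    occ : IsOccurrence (2 + K) (comp (2 + K) (q (2 + K))) (x ◂ I)
    occ zero (suc j) _ (s≤s (s≤s j≤K)) =
      <-≤-trans x←I (ascending-≤ I→ z≤n j≤K) ,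
      SameOrder-resp refl (qᶜ-tail j≤K) (inj₂ (s≤s (s≤s j≤K) , ≤-<-trans (ascending-≤ I↑ j≤K ≤-refl) I↓x))
    occ (suc i) (suc j) (s≤s i<j) (s≤s (s≤s j≤K)) =
      I→ i<j j≤K ,
      SameOrder-resp (qᶜ-tail (≤-trans (<⇒≤ i<j) j≤K)) (qᶜ-tail j≤K) (inj₁ (s≤s i<j , I↑ i<j j≤K))

  r-occurrence : ∀ L z w B → Increasing B L →
    pos z < pos w → val w < val z → pos w < pos (B 0) → val z < val (B 0) →
    Contains π (3 + L) (r (3 + L))
  r-occurrence L z w B (B→ , B↑) z←w w↓z w←B z↓B =
    occurrence⇒contains (3 + L) (r (3 + L)) (z ◂ w ◂ B) occ
    where
    w←Bj : ∀ {j} → j ≤ L → pos w < pos (B j)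
    w←Bj j≤L = <-≤-trans w←B (ascending-≤ B→ z≤n j≤L)
    z↓Bj : ∀ {j} → j ≤ L → val z < val (B j)
    z↓Bj j≤L = <-≤-trans z↓B (ascending-≤ B↑ z≤n j≤L)
    occ : IsOccurrence (3 + L) (r (3 + L)) (z ◂ w ◂ B)
    occ zero (suc zero) _ _ = z←w , inj₂ (s≤s (s≤s z≤n) , w↓z)
    occ zero (suc (suc j)) _ (s≤s (s≤s (s≤s j≤L))) =
      <-trans z←w (w←Bj j≤L) , inj₁ (s≤s (s≤s (s≤s z≤n)) , z↓Bj j≤L)
    occ (suc zero) (suc (suc j)) _ (s≤s (s≤s (s≤s j≤L))) =
      w←Bj j≤L , inj₁ (s≤s (s≤s z≤n) , <-trans w↓z (z↓Bj j≤L))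
    occ (suc (suc i)) (suc (suc j)) (s≤s (s≤s i<j)) (s≤s (s≤s (s≤s j≤L))) =
      B→ i<j j≤L , inj₁ (s≤s (s≤s (s≤s i<j)) , B↑ i<j j≤L)
    occ (suc zero) (suc zero) (s≤s ()) _

  s-occurrence : ∀ K I y → Increasing I K → pos (I K) < pos y → val y < val (I 0) →
    Contains π (2 + K) (s (2 + K))
  s-occurrence K I y (I→ , I↑) I←y y↓I =
    occurrence⇒contains (2 + K) (s (2 + K)) (snocAt K I y) occ
    where
    occ : IsOccurrence (2 + K) (s (2 + K)) (snocAt K I y)
    occ i j i<j (s≤s j≤1+K) with m≤n⇒m<n∨m≡n j≤1+K
    ... | inj₁ (s≤s j≤K) rewrite snocAt-≤ I y (≤-trans (<⇒≤ i<j) j≤K) | snocAt-≤ I y j≤K =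
      I→ i<j j≤K ,
      SameOrder-resp (s-init (≤-trans (<⇒≤ i<j) j≤K)) (s-init j≤K) (inj₁ (s≤s (s≤s i<j) , I↑ i<j j≤K))
    ... | inj₂ refl rewrite snocAt-≤ I y (<⇒≤pred i<j) | snocAt-last K I y =
      ≤-<-trans (ascending-≤ I→ (<⇒≤pred i<j) ≤-refl) I←y ,
      SameOrder-resp (s-init (<⇒≤pred i<j)) (s-last K)
        (inj₂ (s≤s (s≤s z≤n) , <-≤-trans y↓I (ascending-≤ I↑ z≤n (<⇒≤pred i<j))))

  sᶜ-occurrence : ∀ K D J → Decreasing D K → pos (D K) < pos J → val (D 0) < val J →
    Contains π (2 + K) (comp (2 + K) (s (2 + K)))
  sᶜ-occurrence K D J (D→ , D↓) D←J D↓J =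
    occurrence⇒contains (2 + K) (comp (2 + K) (s (2 + K))) (snocAt K D J) occ
    where
    occ : IsOccurrence (2 + K) (comp (2 + K) (s (2 + K))) (snocAt K D J)
    occ i j i<j (s≤s j≤1+K) with m≤n⇒m<n∨m≡n j≤1+K
    ... | inj₁ (s≤s j≤K) rewrite snocAt-≤ D J (≤-trans (<⇒≤ i<j) j≤K) | snocAt-≤ D J j≤K =
      D→ i<j j≤K ,
      SameOrder-resp (sᶜ-init (≤-trans (<⇒≤ i<j) j≤K)) (sᶜ-init j≤K)
        (inj₂ (∸-monoʳ-< i<j (≤-trans j≤K (n≤1+n K)) , D↓ i<j j≤K))
    ... | inj₂ refl rewrite snocAt-≤ D J (<⇒≤pred i<j) | snocAt-last K D J =
      ≤-<-trans (ascending-≤ D→ (<⇒≤pred i<j) ≤-refl) D←J ,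
      SameOrder-resp (sᶜ-init (<⇒≤pred i<j)) (sᶜ-last K)
        (inj₁ (s≤s (m∸n≤m (suc K) i) , ≤-<-trans (descending-≤ D↓ z≤n (<⇒≤pred i<j)) D↓J))

  val-split : ∀ {e e′} → pos e ≢ pos e′ → val e < val e′ ⊎ val e′ < val e
  val-split {e} {e′} pos≢ with <-cmp (val e) (val e′)
  ... | tri< lt _ _ = inj₁ lt
  ... | tri≈ _ eq _ = ⊥-elim (pos≢ (val≡⇒pos≡ eq))
  ... | tri> _ _ gt = inj₂ gt

  pos-split : ∀ {e e′} → val e ≢ val e′ → pos e < pos e′ ⊎ pos e′ < pos e
  pos-split {e} {e′} val≢ with <-cmp (pos e) (pos e′)
  ... | tri< lt _ _ = inj₁ lt
  ... | tri≈ _ eq _ = ⊥-elim (val≢ (pos≡⇒val≡ eq))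
  ... | tri> _ _ gt = inj₂ gt

  data Region (x y a : Fin n) : Set where
    right-of-x-below-x : pos x < pos a → val a < val x → Region x y a
    left-of-x-below-y  : pos a < pos x → val a < val y → Region x y a
    left-of-y-above-y  : pos a < pos y → val y < val a → Region x y a
    right-of-y-above-x : pos y < pos a → val x < val a → Region x y a

  region : ∀ {x y} a → pos x < pos y → val y < val x → Region x y a
  region {x} {y} a x←y y↓x with <-cmp (val a) (val x)
  ... | tri≈ _ a≡x _ =
    left-of-y-above-y (subst (_< pos y) (sym (val≡⇒pos≡ a≡x)) x←y) (subst (val y <_) (sym a≡x) y↓x)
  ... | tri> _ _ x↓a with pos-split (<⇒≢ (<-trans y↓x x↓a) ∘ sym)
  ...   | inj₁ a←y = left-of-y-above-y a←y (<-trans y↓x x↓a)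
  ...   | inj₂ y←a = right-of-y-above-x y←a x↓a
  region {x} {y} a x←y y↓x | tri< a↓x _ _ with pos-split (<⇒≢ a↓x)
  ...   | inj₂ x←a = right-of-x-below-x x←a a↓x
  ...   | inj₁ a←x with val-split (<⇒≢ (<-trans a←x x←y))
  ...     | inj₁ a↓y = left-of-x-below-y a←x a↓y
  ...     | inj₂ y↓a = left-of-y-above-y (<-trans a←x x←y) y↓a

  no-ascent-and-descent : ∀ L → Avoids π (3 + L) (B (3 + L)) →
    ∀ I → Increasing I (L + suc L) → ∀ D → Decreasing D (suc L) → ⊥
  no-ascent-and-descent L (_ ∷ q-free ∷ r-free ∷ s-free ∷ _ ∷ qᶜ-free ∷ _ ∷ sᶜ-free ∷ [])
                        I (I→ , I↑) D D↘@(D→ , D↓) =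
    excluded (region a (D→ (s≤s z≤n) ≤-refl) (D↓ (s≤s z≤n) ≤-refl))
    where
    K = suc L
    a = I 0
    b = I K
    x = D 0
    y = D K
    K≤ : K ≤ L + K
    K≤ = m≤n+m K L
    lower : Increasing I K
    lower = ascending-restrict K≤ I→ , ascending-restrict K≤ I↑
    upper : Increasing (λ i → I (i + K)) L
    upper = ascending-drop I→ , ascending-drop I↑
    a←b : pos a < pos b
    a←b = I→ (s≤s z≤n) K≤
    a↓b : val a < val b
    a↓b = I↑ (s≤s z≤n) K≤
    excluded : Region x y a → ⊥
    excluded (right-of-x-below-x x←a a↓x) with val-split (<⇒≢ (<-trans x←a a←b) ∘ sym)
    ... | inj₁ b↓x = qᶜ-free (qᶜ-occurrence K x I lower x←a b↓x)
    ... | inj₂ x↓b = r-free (r-occurrence L x a (λ i → I (i + K)) upper x←a a↓x a←b x↓b)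
    excluded (left-of-x-below-y a←x a↓y) = q-free (q-occurrence K a D D↘ a←x a↓y)
    excluded (left-of-y-above-y a←y y↓a) with pos-split (<⇒≢ (<-trans y↓a a↓b) ∘ sym)
    ... | inj₁ b←y = s-free (s-occurrence K I y lower b←y y↓a)
    ... | inj₂ y←b = r-free (r-occurrence L a y (λ i → I (i + K)) upper a←y y↓a y←b a↓b)
    excluded (right-of-y-above-x y←a x↓a) = sᶜ-free (sᶜ-occurrence K D a D↘ y←a x↓a)

  long-ascent⇒short-descent : ∀ L → Avoids π (3 + L) (B (3 + L)) →
    ∀ {a d} → HasIncSub π a → HasDecSub π d → suc L + suc L ≤ a → d ≤ suc L
  long-ascent⇒short-descent L avoids inc dec 2K≤a = ≮⇒≥ λ K<d →
    let I , I↗ = increasing-prefix inc 2K≤a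
        D , D↘ = decreasing-prefix dec K<d
    in no-ascent-and-descent L avoids I I↗ D D↘

opposite-injective : ∀ {n} → Injective _≡_ _≡_ (opposite {n})
opposite-injective {_} {i} {j} eq =
  trans (sym (opposite-involutive i)) (trans (cong opposite eq) (opposite-involutive j))

opposite-<-⇔ : ∀ {n} (i j : Fin n) → (toℕ (opposite i) < toℕ (opposite j)) ⇔ (toℕ j < toℕ i)
opposite-<-⇔ {n} i j = mk⇔
  (λ lt → ≤-pred (∸-cancelʳ-< {o = n} (subst₂ _<_ (opposite-prop i) (opposite-prop j) lt)))
  (λ j<i → subst₂ _<_ (sym (opposite-prop i)) (sym (opposite-prop j)) (∸-monoʳ-< (s≤s j<i) (toℕ<n i)))

∸-<-⇔ : ∀ {N u v} → u ≤ N → (N ∸ u < N ∸ v) ⇔ (v < u)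
∸-<-⇔ u≤N = mk⇔ ∸-cancelʳ-< (λ v<u → ∸-monoʳ-< v<u u≤N)

complement : ∀ {n} → Perm n → Perm n
complement π = record { fun = opposite ∘ fun π ; inj = inj π ∘ opposite-injective }

ascent⇒complement-descent : ∀ {n} (π : Perm n) {m} → HasIncSub π m → HasDecSub (complement π) m
ascent⇒complement-descent π (f , f↑ , πf↑) =
  f , f↑ , λ i j i<j → Equivalence.from (opposite-<-⇔ (fun π (f j)) (fun π (f i))) (πf↑ i j i<j)

descent⇒complement-ascent : ∀ {n} (π : Perm n) {m} → HasDecSub π m → HasIncSub (complement π) m
descent⇒complement-ascent π (f , f↑ , πf↓) =
  f , f↑ , λ i j i<j → Equivalence.from (opposite-<-⇔ (fun π (f i)) (fun π (f j))) (πf↓ i j i<j)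

-- The complement k + 1 ∸ σ(j) is only an involution on patterns with values ≤ k + 1.
Bounded : ℕ → Pattern → Set
Bounded k σ = ∀ (i : Fin k) → σ (suc (toℕ i)) ≤ suc k

comp-bounded : ∀ k σ → Bounded k (comp k σ)
comp-bounded k σ i = m∸n≤m (suc k) (σ (suc (toℕ i)))

comp-involutive : ∀ k σ → Bounded k σ →
  ∀ (i : Fin k) → comp k (comp k σ) (suc (toℕ i)) ≡ σ (suc (toℕ i))
comp-involutive k σ σ≤ i = m∸[m∸n]≡n (σ≤ i)

contains-cong : ∀ {n} (π : Perm n) k σ τ → (∀ (i : Fin k) → σ (suc (toℕ i)) ≡ τ (suc (toℕ i))) →
  Contains π k σ → Contains π k τ
contains-cong π k σ τ σ≗τ (f , f↑ , iso) =
  f , f↑ , λ i j → subst₂ (λ u v → (u < v) ⇔ _) (σ≗τ i) (σ≗τ j) (iso i j)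

complement-contains : ∀ {n} (π : Perm n) k σ → Bounded k σ →
  Contains (complement π) k σ → Contains π k (comp k σ)
complement-contains π k σ σ≤ (f , f↑ , iso) = f , f↑ , λ i j →
  opposite-<-⇔ (fun π (f j)) (fun π (f i)) ⇔-∘ (iso j i ⇔-∘ ∸-<-⇔ (σ≤ i))

complement-avoids-pair : ∀ {n} (π : Perm n) k σ → Bounded k σ →
  ¬ Contains π k σ → ¬ Contains π k (comp k σ) →
  ¬ Contains (complement π) k σ × ¬ Contains (complement π) k (comp k σ)
complement-avoids-pair π k σ σ≤ σ-free σᶜ-free =
  σᶜ-free ∘ complement-contains π k σ σ≤ ,
  σ-free ∘ contains-cong π k (comp k (comp k σ)) σ (comp-involutive k σ σ≤)
         ∘ complement-contains π k (comp k σ) (comp-bounded k σ)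

if-bounded : ∀ {N x y} b → x ≤ N → y ≤ N → (if b then x else y) ≤ N
if-bounded true  x≤N _   = x≤N
if-bounded false _   y≤N = y≤N

position-bounded : ∀ {k} (i : Fin k) → suc (toℕ i) ≤ suc k
position-bounded {k} i = ≤-trans (toℕ<n i) (n≤1+n k)

p-bounded : ∀ k → Bounded k (p k)
p-bounded k i = if-bounded (suc (toℕ i) ≤ᵇ k ∸ 2) (position-bounded i)
  (if-bounded (suc (toℕ i) ≤ᵇ k ∸ 1) (n≤1+n k) (≤-trans (m∸n≤m k 1) (n≤1+n k)))

q-bounded : ∀ k → Bounded k (q k)
q-bounded k i = if-bounded (suc (toℕ i) ≤ᵇ 1) (s≤s z≤n)
  (subst (λ t → t ∸ suc (toℕ i) ≤ suc k) (+-comm 2 k) (m∸n≤m (suc k) (toℕ i)))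

r-bounded : ∀ k → Bounded k (r k)
r-bounded (suc k) i = if-bounded (suc (toℕ i) ≤ᵇ 1) (s≤s (s≤s z≤n))
  (if-bounded (suc (toℕ i) ≤ᵇ 2) (s≤s z≤n) (position-bounded i))

s-bounded : ∀ k → Bounded k (s k)
s-bounded k i = if-bounded (suc (toℕ i) ≤ᵇ k ∸ 1) (s≤s (toℕ<n i)) (s≤s z≤n)

complement-avoids : ∀ {n} (π : Perm n) k → Avoids π k (B k) → Avoids (complement π) k (B k)
complement-avoids π k (p-free ∷ q-free ∷ r-free ∷ s-free ∷ pᶜ-free ∷ qᶜ-free ∷ rᶜ-free ∷ sᶜ-free ∷ [])
  with complement-avoids-pair π k (p k) (p-bounded k) p-free pᶜ-free
     | complement-avoids-pair π k (q k) (q-bounded k) q-free qᶜ-free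
     | complement-avoids-pair π k (r k) (r-bounded k) r-free rᶜ-free
     | complement-avoids-pair π k (s k) (s-bounded k) s-free sᶜ-free
... | p′ , pᶜ′ | q′ , qᶜ′ | r′ , rᶜ′ | s′ , sᶜ′ =
  p′ ∷ q′ ∷ r′ ∷ s′ ∷ pᶜ′ ∷ qᶜ′ ∷ rᶜ′ ∷ sᶜ′ ∷ []

proposition7p1 : ∀ (k : ℕ) → 4 ≤ k → ∀ {n : ℕ} (π : Perm n) → Avoids π k (B k) →
    (∀ (a d : ℕ) → IsLIS π a → IsLDS π d → 2 * k ∸ 4 ≤ a → d ≤ k ∸ 2) ×
    (∀ (a d : ℕ) → IsLIS π a → IsLDS π d → 2 * k ∸ 4 ≤ d → a ≤ k ∸ 2)
proposition7p1 (suc (suc (suc L))) (s≤s (s≤s (s≤s _))) π avoids =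
  (λ a d (inc , _) (dec , _) 2k-4≤a →
     long-ascent⇒short-descent π L avoids inc dec (subst (_≤ a) 2k-4≡2K 2k-4≤a)) ,
  (λ a d (inc , _) (dec , _) 2k-4≤d →
     long-ascent⇒short-descent (complement π) L (complement-avoids π _ avoids)
       (descent⇒complement-ascent π dec) (ascent⇒complement-descent π inc) (subst (_≤ d) 2k-4≡2K 2k-4≤d))
  where
  2k-4≡2K : 2 * (3 + L) ∸ 4 ≡ suc L + suc L
  2k-4≡2K rewrite +-identityʳ L | +-suc L (suc (suc L)) | +-suc L (suc L) = refl
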